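{- Standard MergeSort with exponential merging has a fragile complexity of $O(\log^2 n)$ in the worst case: on every input of $n$ elements every element participates in $O(\log^2 n)$ comparisons.
   Context: Standard MergeSort divides the $n$ input elements into two sets of sizes $\lceil n/2\rceil$ and $\lfloor n/2\rfloor$, recursively sorts these, and merges the two sorted sequences. Exponential merging of sorted sequences $A=(a_1,\dots,a_n)$ and $B=(b_1,\dots,b_m)$: if either is empty, output the other and stop. Otherwise (padding $B$ conceptually with virtual elements larger than $a_1$ so that its length is a power of two and some $b_i>a_1$ exists), perform an exponential search on $B$: a doubling phase compares $a_1$ with $b_{2^0},b_{2^1},\dots$ to find the smallest $k$ with $a_1<b_{2^k}$, followed by a binary search between $b_{2^{k-1}}$ and $b_{2^k}$ to find the largest $\ell$ with $b_\ell<a_1$. Output $b_1,\dots,b_\ell,a_1$ and recurse on $(b_{\ell+1},\dots,b_m)$ and $(a_2,\dots,a_n)$, with the roles of the two sequences swapped. -}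

module Defs where

open import Data.Nat using (ℕ; zero; suc; _+_; _*_; _∸_; _^_; _<ᵇ_; ⌈_/2⌉)
open import Data.Nat.Properties using (_≟_)
open import Data.Bool using (Bool; true; false)
open import Data.List using (List; []; _∷_; _++_; length; take; drop; filter)
open import Data.Maybe using (Maybe; just; nothing)
open import Data.Product using (_×_; _,_; proj₁; proj₂)

-- All procedures return their result together with a LOG: a list of
-- elements, in which each comparison appends the (real) elements that
-- take part in it.  A comparison of a real element with a virtual
-- (padding) element is logged for the real element only.

-- 1-indexed access b_i; `nothing` = virtual padding element (i > length B).
at : List ℕ → ℕ → Maybe ℕ
at [] _ = nothing
at (x ∷ xs) zero = nothing
at (x ∷ xs) (suc zero) = just x
at (x ∷ xs) (suc (suc i)) = at xs (suc i)

less : ℕ → Maybe ℕ → Bool × List ℕ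
less a nothing = true , a ∷ []
less a (just b) = (a <ᵇ b) , a ∷ b ∷ []

-- doubling phase: smallest k (starting from the given one) with a < b_{2^k}.
-- The first argument is fuel; length B + 1 steps always suffice,
-- since b_{2^k} is virtual as soon as 2^k > length B.
doubling : ℕ → ℕ → List ℕ → ℕ → ℕ × List ℕ
doubling zero a B k = k , []
doubling (suc f) a B k with less a (at B (2 ^ k))
... | true , l = k , l
... | false , l with doubling f a B (suc k)
...   | k' , l' = k' , l ++ l'

-- binary search: invariant b_lo < a (or lo = 0) and a < b_{lo + 2^j};
-- returns the largest ℓ with b_ℓ < a.
bsearch : ℕ → List ℕ → ℕ → ℕ → ℕ × List ℕ
bsearch a B zero lo = lo , []
bsearch a B (suc j) lo with less a (at B (lo + 2 ^ j))
... | true , l with bsearch a B j lo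
...   | r , l' = r , l ++ l'
bsearch a B (suc j) lo | false , l with bsearch a B j (lo + 2 ^ j)
...   | r , l' = r , l ++ l'

expSearch : ℕ → List ℕ → ℕ × List ℕ
expSearch a B with doubling (suc (length B)) a B 0
... | zero , l = 0 , l
... | suc k , l with bsearch a B k (2 ^ k)
...   | ℓ , l' = ℓ , l ++ l'

-- exponential merging of A and B (fuel: length A + length B suffices,
-- as every round removes a_1).
expMerge : ℕ → List ℕ → List ℕ → List ℕ × List ℕ
expMerge zero A B = A ++ B , []
expMerge (suc f) [] B = B , []
expMerge (suc f) (a ∷ A) [] = a ∷ A , []
expMerge (suc f) (a ∷ A) (b ∷ B) with expSearch a (b ∷ B)
... | ℓ , l with expMerge f (drop ℓ (b ∷ B)) A
...   | out , l' = take ℓ (b ∷ B) ++ (a ∷ out) , l ++ l'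

msort : ℕ → List ℕ → List ℕ × List ℕ
msort zero xs = xs , []
msort (suc f) [] = [] , []
msort (suc f) (x ∷ []) = x ∷ [] , []
msort (suc f) (x ∷ y ∷ zs) with msort f (take ⌈ length (x ∷ y ∷ zs) /2⌉ (x ∷ y ∷ zs))
                              | msort f (drop ⌈ length (x ∷ y ∷ zs) /2⌉ (x ∷ y ∷ zs))
... | s₁ , l₁ | s₂ , l₂ with expMerge (length (x ∷ y ∷ zs)) s₁ s₂
...   | m , l₃ = m , l₁ ++ l₂ ++ l₃

mergeSort : List ℕ → List ℕ × List ℕ
mergeSort xs = msort (length xs) xs

participations : ℕ → List ℕ → ℕ
participations x xs = length (filter (x ≟_) (proj₂ (mergeSort xs)))

module Submission where

-- Fix an element x occurring once in the input.  In an exponential merge of two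
-- lists of length < 2^L, x takes part in O(L) comparisons: O(L) in the single
-- exponential search it performs itself, and otherwise only in searches that
-- probe its own position in the searched list.  Such a search costs x at most two
-- comparisons, and it returns ℓ with p ≤ 2ℓ, where p elements precede x; so either
-- x is output or the number of elements in front of it halves.  Hence x is hit
-- O(L) times before it leaves its list.  Summing over the ⌈log₂ n⌉ levels of
-- MergeSort, in each of which x takes part in one merge, gives O(log² n).  None of
-- this uses sortedness: it is a property of the probe pattern alone.

open import Defs
open import Data.Nat using (ℕ; _≤_; _*_; _^_)
open import Data.Nat.Logarithm using (⌈log₂_⌉)
open import Data.List using (List; length)
open import Data.List.Membership.Propositional using (_∈_)
open import Data.List.Relation.Unary.Unique.Propositional using (Unique)
open import Data.Product using (∃₂)
open import Data.Nat hiding (less)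
open import Data.Nat.Properties
open import Data.Nat.Induction using (<-rec)
open import Data.Nat.Solver using (module +-*-Solver)
open import Data.Nat.Logarithm using (⌈log₂⌉-mono-≤; ⌈log₂⌈n/2⌉⌉≡⌈log₂n⌉∸1)
open import Data.Bool using (true; false)
open import Data.List using ([]; _∷_; _++_; take; drop; filter)
open import Data.List.Properties
  using (filter-accept; filter-reject; filter-++; filter-none; length-++; length-filter; length-drop; length-take; take++drop≡id; ++-assoc; ++-identityʳ)
open import Data.List.Relation.Binary.Permutation.Propositional using (_↭_; ↭-refl; ↭-reflexive; ↭-prep; module PermutationReasoning)
open import Data.List.Relation.Binary.Permutation.Propositional.Properties
  using (↭-length; filter-↭; ++⁺; ++⁺ˡ; shift; ++-comm)
open import Data.List.Relation.Unary.AllPairs using ([]; _∷_)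
open import Data.Maybe using (just; nothing)
open import Data.Product using (_×_; _,_; proj₁; proj₂; ∃)
open import Data.Sum using (_⊎_; inj₁; inj₂)
open import Relation.Nullary using (yes; no; contradiction)
open import Relation.Binary.PropositionalEquality
open import Function using (_∘_)

occ : ℕ → List ℕ → ℕ
occ x xs = length (filter (x ≟_) xs)

occ-here : ∀ x xs → occ x (x ∷ xs) ≡ suc (occ x xs)
occ-here x xs = cong length (filter-accept (x ≟_) refl)

occ-there : ∀ {x y} xs → x ≢ y → occ x (y ∷ xs) ≡ occ x xs
occ-there {x} xs x≢y = cong length (filter-reject (x ≟_) x≢y)

occ-++ : ∀ x xs ys → occ x (xs ++ ys) ≡ occ x xs + occ x ys
occ-++ x xs ys = trans (cong length (filter-++ (x ≟_) xs ys)) (length-++ (filter (x ≟_) xs))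

occ≤length : ∀ x xs → occ x xs ≤ length xs
occ≤length x = length-filter (x ≟_)

occ-↭ : ∀ x {xs ys} → xs ↭ ys → occ x xs ≡ occ x ys
occ-↭ x xs↭ys = ↭-length (filter-↭ (x ≟_) xs↭ys)

occ-∷-≤ : ∀ x y xs → occ x xs ≤ occ x (y ∷ xs)
occ-∷-≤ x y xs with x ≟ y
... | yes refl = ≤-trans (n≤1+n _) (≤-reflexive (sym (occ-here x xs)))
... | no x≢y = ≤-reflexive (sym (occ-there xs x≢y))

occ-∷-0 : ∀ {x y} xs → occ x (y ∷ xs) ≡ 0 → occ x xs ≡ 0
occ-∷-0 {x} {y} xs eq = n≤0⇒n≡0 (subst (occ x xs ≤_) eq (occ-∷-≤ x y xs))

occ-∷-0⇒≢ : ∀ {x y} xs → occ x (y ∷ xs) ≡ 0 → x ≢ y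
occ-∷-0⇒≢ {x} xs eq refl with () ← trans (sym (occ-here x xs)) eq

occ-drop-0 : ∀ {x} n xs → occ x xs ≡ 0 → occ x (drop n xs) ≡ 0
occ-drop-0 zero xs eq = eq
occ-drop-0 (suc n) [] eq = eq
occ-drop-0 (suc n) (y ∷ xs) eq = occ-drop-0 n xs (occ-∷-0 xs eq)

Unique⇒occ≤1 : ∀ x {xs} → Unique xs → occ x xs ≤ 1
Unique⇒occ≤1 x [] = z≤n
Unique⇒occ≤1 x {y ∷ ys} (y∉ys ∷ unique) with x ≟ y
... | yes refl = ≤-reflexive (trans (occ-here x ys) (cong (suc ∘ length) (filter-none (x ≟_) y∉ys)))
... | no x≢y = ≤-trans (≤-reflexive (occ-there ys x≢y)) (Unique⇒occ≤1 x unique)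

data OnceAt (x : ℕ) : ℕ → List ℕ → Set where
  here  : ∀ {xs} → occ x xs ≡ 0 → OnceAt x 0 (x ∷ xs)
  there : ∀ {p y xs} → x ≢ y → OnceAt x p xs → OnceAt x (suc p) (y ∷ xs)

occ≡1⇒OnceAt : ∀ {x} xs → occ x xs ≡ 1 → ∃ λ p → OnceAt x p xs
occ≡1⇒OnceAt {x} (y ∷ xs) eq with x ≟ y
... | yes refl = 0 , here (suc-injective (trans (sym (occ-here x xs)) eq))
... | no x≢y with p , once ← occ≡1⇒OnceAt xs (trans (sym (occ-there xs x≢y)) eq) = suc p , there x≢y once

OnceAt⇒<length : ∀ {x p xs} → OnceAt x p xs → p < length xs
OnceAt⇒<length (here _) = z<s
OnceAt⇒<length (there _ once) = s<s (OnceAt⇒<length once)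

OnceAt-drop : ∀ {x p xs} ℓ → OnceAt x p xs → ℓ ≤ p → OnceAt x (p ∸ ℓ) (drop ℓ xs)
OnceAt-drop zero once _ = once
OnceAt-drop (suc ℓ) (there _ once) (s≤s ℓ≤p) = OnceAt-drop ℓ once ℓ≤p

OnceAt-drop-past : ∀ {x p xs} ℓ → OnceAt x p xs → p < ℓ → occ x (drop ℓ xs) ≡ 0
OnceAt-drop-past (suc ℓ) (here x∉xs) _ = occ-drop-0 ℓ _ x∉xs
OnceAt-drop-past (suc ℓ) (there _ once) (s<s p<ℓ) = OnceAt-drop-past ℓ once p<ℓ

at⇒occ : ∀ {y} xs i → at xs i ≡ just y → 0 < occ y xs
at⇒occ (x ∷ xs) (suc zero) refl = subst (0 <_) (sym (occ-here x xs)) z<s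
at⇒occ (x ∷ xs) (suc (suc i)) eq = ≤-trans (at⇒occ xs (suc i) eq) (occ-∷-≤ _ x xs)

at-just⇒≤length : ∀ xs i {y} → at xs i ≡ just y → i ≤ length xs
at-just⇒≤length (x ∷ xs) (suc zero) refl = s≤s z≤n
at-just⇒≤length (x ∷ xs) (suc (suc i)) eq = s≤s (at-just⇒≤length xs (suc i) eq)

at-OnceAt : ∀ {x p xs} i → OnceAt x p xs → at xs i ≡ just x → i ≡ suc p
at-OnceAt (suc zero) (here _) _ = refl
at-OnceAt {xs = _ ∷ xs} (suc (suc i)) (here x∉xs) eq =
  contradiction (subst (0 <_) x∉xs (at⇒occ xs (suc i) eq)) (λ ())
at-OnceAt (suc zero) (there x≢y _) refl = contradiction refl x≢y
at-OnceAt (suc (suc i)) (there _ once) eq = cong suc (at-OnceAt (suc i) once eq)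

less-log-length : ∀ a m → length (proj₂ (less a m)) ≤ 2
less-log-length a nothing = s≤s z≤n
less-log-length a (just b) = ≤-refl

less-occ : ∀ {x a} → x ≢ a → ∀ m →
           occ x (proj₂ (less a m)) ≡ 0 ⊎ (m ≡ just x × occ x (proj₂ (less a m)) ≡ 1)
less-occ x≢a nothing = inj₁ (occ-there [] x≢a)
less-occ {x} x≢a (just b) with x ≟ b
... | yes refl = inj₂ (refl , trans (occ-there (x ∷ []) x≢a) (occ-here x []))
... | no x≢b = inj₁ (trans (occ-there (b ∷ []) x≢a) (occ-there [] x≢b))

probeCost : ℕ → ℕ → List ℕ → ℕ → ℕ
probeCost x a B i = occ x (proj₂ (less a (at B i)))

-- Probe indices are 1-based and index 0 is never probed, so `HitOnlyAt 0 w`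
-- says that no probe involves x.
HitOnlyAt : ℕ → (ℕ → ℕ) → Set
HitOnlyAt q w = ∀ i → w i ≡ 0 ⊎ (i ≡ q × w i ≡ 1)

probeCost-absent : ∀ {x a B} → x ≢ a → occ x B ≡ 0 → HitOnlyAt 0 (probeCost x a B)
probeCost-absent {B = B} x≢a x∉B i with less-occ x≢a (at B i)
... | inj₁ none = inj₁ none
... | inj₂ (eq , _) = contradiction (subst (0 <_) x∉B (at⇒occ B i eq)) (λ ())

probeCost-OnceAt : ∀ {x a p B} → x ≢ a → OnceAt x p B → HitOnlyAt (suc p) (probeCost x a B)
probeCost-OnceAt {B = B} x≢a once i with less-occ x≢a (at B i)
... | inj₁ none = inj₁ none
... | inj₂ (eq , one) = inj₂ (at-OnceAt i once eq , one)

-- c is how often a run of probes at distinct indices in [lo, hi) involves x,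
-- when only the probe at index q can.
Hits : ℕ → ℕ → ℕ → ℕ → Set
Hits q lo hi c = c ≡ 0 ⊎ (c ≡ 1 × lo ≤ q × q < hi)

Hits-weaken : ∀ {q lo lo′ hi hi′ c} → lo ≤ lo′ → hi′ ≤ hi → Hits q lo′ hi′ c → Hits q lo hi c
Hits-weaken _ _ (inj₁ none) = inj₁ none
Hits-weaken lo≤ ≤hi (inj₂ (one , lo′≤q , q<hi′)) = inj₂ (one , ≤-trans lo≤ lo′≤q , <-≤-trans q<hi′ ≤hi)

Hits-+ : ∀ {q lo mid hi c₁ c₂} → lo ≤ mid → mid ≤ hi →
         Hits q lo mid c₁ → Hits q mid hi c₂ → Hits q lo hi (c₁ + c₂)
Hits-+ _ _ (inj₁ refl) (inj₁ refl) = inj₁ refl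
Hits-+ _ mid≤hi (inj₂ (refl , lo≤q , q<mid)) (inj₁ refl) = inj₂ (refl , lo≤q , <-≤-trans q<mid mid≤hi)
Hits-+ lo≤mid _ (inj₁ refl) (inj₂ (refl , mid≤q , q<hi)) = inj₂ (refl , ≤-trans lo≤mid mid≤q , q<hi)
Hits-+ _ _ (inj₂ (_ , _ , q<mid)) (inj₂ (_ , mid≤q , _)) = contradiction q<mid (≤⇒≯ mid≤q)

Hits⇒≤1 : ∀ {q lo hi c} → Hits q lo hi c → c ≤ 1
Hits⇒≤1 (inj₁ refl) = z≤n
Hits⇒≤1 (inj₂ (refl , _)) = ≤-refl

Hits⇒range : ∀ {q lo hi c lo′ m} → lo′ ≤ lo → hi ≤ suc m → Hits q lo hi c → c ≡ 0 ⊎ (lo′ ≤ q × q ≤ m)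
Hits⇒range _ _ (inj₁ none) = inj₁ none
Hits⇒range lo′≤lo hi≤m (inj₂ (_ , lo≤q , q<hi)) = inj₂ (≤-trans lo′≤lo lo≤q , s≤s⁻¹ (<-≤-trans q<hi hi≤m))

zeroOr-+ : ∀ {c c′} {P : Set} → c ≡ 0 ⊎ P → c′ ≡ 0 ⊎ P → c + c′ ≡ 0 ⊎ P
zeroOr-+ (inj₁ refl) (inj₁ refl) = inj₁ refl
zeroOr-+ (inj₂ p) _ = inj₂ p
zeroOr-+ (inj₁ _) (inj₂ p) = inj₂ p

2^>0 : ∀ k → 0 < 2 ^ k
2^>0 = m^n>0 2

1+2^k≤2^1+k : ∀ k → suc (2 ^ k) ≤ 2 ^ suc k
1+2^k≤2^1+k k = ≤-trans (≤-reflexive (+-comm 1 (2 ^ k))) (+-monoʳ-≤ (2 ^ k) (≤-trans (2^>0 k) (m≤m+n (2 ^ k) 0)))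

doubling-≥ : ∀ f a B k → k ≤ proj₁ (doubling f a B k)
doubling-≥ zero a B k = ≤-refl
doubling-≥ (suc f) a B k with less a (at B (2 ^ k))
... | true , _ = ≤-refl
... | false , _ = ≤-trans (n≤1+n k) (doubling-≥ f a B (suc k))

bsearch-≥ : ∀ a B j lo → lo ≤ proj₁ (bsearch a B j lo)
bsearch-≥ a B zero lo = ≤-refl
bsearch-≥ a B (suc j) lo with less a (at B (lo + 2 ^ j))
... | true , _ = bsearch-≥ a B j lo
... | false , _ = ≤-trans (m≤m+n lo (2 ^ j)) (bsearch-≥ a B j (lo + 2 ^ j))

module _ {x a B q} (hitOnly : HitOnlyAt q (probeCost x a B)) where

  probe-hits : ∀ i → Hits q i (suc i) (probeCost x a B i)
  probe-hits i with hitOnly i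
  ... | inj₁ none = inj₁ none
  ... | inj₂ (refl , one) = inj₂ (one , ≤-refl , ≤-refl)

  doubling-hits : ∀ f k → Hits q (2 ^ k) (suc (2 ^ proj₁ (doubling f a B k))) (occ x (proj₂ (doubling f a B k)))
  doubling-hits zero k = inj₁ refl
  doubling-hits (suc f) k with less a (at B (2 ^ k)) | probe-hits (2 ^ k)
  ... | true , _ | hit = hit
  ... | false , l | hit
    rewrite occ-++ x l (proj₂ (doubling f a B (suc k))) =
      Hits-+ (^-monoʳ-≤ 2 (n≤1+n k)) (≤-trans (^-monoʳ-≤ 2 (doubling-≥ f a B (suc k))) (n≤1+n _))
        (Hits-weaken ≤-refl (1+2^k≤2^1+k k) hit) (doubling-hits f (suc k))

  bsearch-hits : ∀ j lo → Hits q (suc lo) (lo + 2 ^ j) (occ x (proj₂ (bsearch a B j lo)))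
  bsearch-hits zero lo = inj₁ refl
  bsearch-hits (suc j) lo with less a (at B (lo + 2 ^ j)) | probe-hits (lo + 2 ^ j)
  ... | true , l | hit
    rewrite occ-++ x l (proj₂ (bsearch a B j lo)) | +-comm (occ x l) (occ x (proj₂ (bsearch a B j lo))) =
      Hits-+ (m<m+n lo (2^>0 j)) (+-monoʳ-≤ lo (^-monoʳ-≤ 2 (n≤1+n j)))
        (bsearch-hits j lo) (Hits-weaken ≤-refl probe<hi hit)
    where
    probe<hi : suc (lo + 2 ^ j) ≤ lo + 2 ^ suc j
    probe<hi = ≤-trans (≤-reflexive (sym (+-suc lo (2 ^ j)))) (+-monoʳ-≤ lo (1+2^k≤2^1+k j))
  ... | false , l | hit
    rewrite occ-++ x l (proj₂ (bsearch a B j (lo + 2 ^ j))) =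
      Hits-weaken (m<m+n lo (2^>0 j)) (≤-reflexive lo+2^j+2^j≡lo+2^1+j)
        (Hits-+ (n≤1+n _) (m<m+n (lo + 2 ^ j) (2^>0 j)) hit (bsearch-hits j (lo + 2 ^ j)))
    where
    lo+2^j+2^j≡lo+2^1+j : lo + 2 ^ j + 2 ^ j ≡ lo + 2 ^ suc j
    lo+2^j+2^j≡lo+2^1+j = trans (+-assoc lo (2 ^ j) (2 ^ j)) (cong (λ n → lo + (2 ^ j + n)) (sym (+-identityʳ (2 ^ j))))

  -- The probe intervals of the two phases overlap, hence the bound 2 rather than 1.
  expSearch-hits : occ x (proj₂ (expSearch a B)) ≤ 2 ×
                   (occ x (proj₂ (expSearch a B)) ≡ 0 ⊎ (1 ≤ q × q ≤ suc (2 * proj₁ (expSearch a B))))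
  expSearch-hits with doubling (suc (length B)) a B 0 | doubling-hits (suc (length B)) 0
  ... | zero , l | hit = ≤-trans (Hits⇒≤1 hit) (n≤1+n 1) , Hits⇒range ≤-refl ≤-refl hit
  ... | suc k , l | hit with bsearch a B k (2 ^ k) | bsearch-hits k (2 ^ k) | bsearch-≥ a B k (2 ^ k)
  ...   | ℓ , l′ | hit′ | 2^k≤ℓ rewrite occ-++ x l l′ =
        +-mono-≤ (Hits⇒≤1 hit) (Hits⇒≤1 hit′) ,
        zeroOr-+ (Hits⇒range ≤-refl (s≤s (≤-trans 2^1+k≤2ℓ (n≤1+n _))) hit)
                 (Hits⇒range (s≤s z≤n) (≤-trans 2^k+2^k≤2^1+k (≤-trans 2^1+k≤2ℓ (m≤n+m (2 * ℓ) 2))) hit′)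
    where
    2^1+k≤2ℓ : 2 ^ suc k ≤ 2 * ℓ
    2^1+k≤2ℓ = *-monoʳ-≤ 2 2^k≤ℓ
    2^k+2^k≤2^1+k : 2 ^ k + 2 ^ k ≤ 2 ^ suc k
    2^k+2^k≤2^1+k = +-monoʳ-≤ (2 ^ k) (m≤m+n (2 ^ k) 0)

expSearch-absent : ∀ {x a B} → x ≢ a → occ x B ≡ 0 → occ x (proj₂ (expSearch a B)) ≡ 0
expSearch-absent {x} {a} {B} x≢a x∉B with proj₂ (expSearch-hits {x} {a} {B} (probeCost-absent {B = B} x≢a x∉B))
... | inj₁ none = none
... | inj₂ (() , _)

searchBound : ℕ → ℕ
searchBound L = suc L * 2 + L * 2

module _ (a : ℕ) (B : List ℕ) {L : ℕ} (|B|<2^L : length B < 2 ^ L) where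

  probed⇒<L : ∀ {k b} → at B (2 ^ k) ≡ just b → k < L
  probed⇒<L {k} eq = ≰⇒> (λ L≤k → <⇒≱ (≤-<-trans (at-just⇒≤length B (2 ^ k) eq) |B|<2^L) (^-monoʳ-≤ 2 L≤k))

  doubling-≤ : ∀ f k → k ≤ L → proj₁ (doubling f a B k) ≤ L
  doubling-≤ zero k k≤L = k≤L
  doubling-≤ (suc f) k k≤L with at B (2 ^ k) in eq
  ... | nothing = k≤L
  ... | just b with a <ᵇ b
  ...   | true = k≤L
  ...   | false = doubling-≤ f (suc k) (probed⇒<L eq)

  doubling-log-length : ∀ f k → length (proj₂ (doubling f a B k)) ≤ suc (L ∸ k) * 2
  doubling-log-length zero k = z≤n
  doubling-log-length (suc f) k with at B (2 ^ k) in eq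
  ... | nothing = s≤s z≤n
  ... | just b with a <ᵇ b
  ...   | true = m≤m+n 2 _
  ...   | false = s≤s (s≤s (≤-trans (doubling-log-length f (suc k))
                    (≤-reflexive (cong (λ n → n * 2) (sym (+-∸-assoc 1 (probed⇒<L eq)))))))

bsearch-log-length : ∀ a B j lo → length (proj₂ (bsearch a B j lo)) ≤ j * 2
bsearch-log-length a B zero lo = z≤n
bsearch-log-length a B (suc j) lo with less a (at B (lo + 2 ^ j)) | less-log-length a (at B (lo + 2 ^ j))
... | true , l | l≤2 = ≤-trans (≤-reflexive (length-++ l)) (+-mono-≤ l≤2 (bsearch-log-length a B j lo))
... | false , l | l≤2 = ≤-trans (≤-reflexive (length-++ l)) (+-mono-≤ l≤2 (bsearch-log-length a B j (lo + 2 ^ j)))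

expSearch-log-length : ∀ a B {L} → length B < 2 ^ L → length (proj₂ (expSearch a B)) ≤ searchBound L
expSearch-log-length a B {L} |B|<2^L
  with doubling (suc (length B)) a B 0
     | doubling-≤ a B {L} |B|<2^L (suc (length B)) 0 z≤n
     | doubling-log-length a B {L} |B|<2^L (suc (length B)) 0
... | zero , l | _ | l≤ = ≤-trans l≤ (m≤m+n _ _)
... | suc k , l | k<L | l≤ =
  ≤-trans (≤-reflexive (length-++ l)) (+-mono-≤ l≤ (≤-trans (bsearch-log-length a B k (2 ^ k)) (*-monoˡ-≤ 2 (<⇒≤ k<L))))

length-drop-≤ : ∀ ℓ (xs : List ℕ) → length (drop ℓ xs) ≤ length xs
length-drop-≤ ℓ xs = ≤-trans (≤-reflexive (length-drop ℓ xs)) (m∸n≤m _ ℓ)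

p≤2ℓ⇒2[p∸ℓ]≤p : ∀ {p ℓ} → ℓ ≤ p → p ≤ 2 * ℓ → 2 * (p ∸ ℓ) ≤ p
p≤2ℓ⇒2[p∸ℓ]≤p {p} {ℓ} ℓ≤p p≤2ℓ = begin
    2 * (p ∸ ℓ)          ≡⟨ cong ((p ∸ ℓ) +_) (+-identityʳ (p ∸ ℓ)) ⟩
    (p ∸ ℓ) + (p ∸ ℓ)    ≤⟨ +-monoˡ-≤ (p ∸ ℓ) p∸ℓ≤ℓ ⟩
    ℓ + (p ∸ ℓ)          ≡⟨ m+[n∸m]≡n ℓ≤p ⟩
    p                    ∎
  where
  open ≤-Reasoning
  p∸ℓ≤ℓ : p ∸ ℓ ≤ ℓ
  p∸ℓ≤ℓ = +-cancelˡ-≤ ℓ (p ∸ ℓ) ℓ (begin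
    ℓ + (p ∸ ℓ)  ≡⟨ m+[n∸m]≡n ℓ≤p ⟩
    p            ≤⟨ p≤2ℓ ⟩
    ℓ + (ℓ + 0)  ≡⟨ cong (ℓ +_) (+-identityʳ ℓ) ⟩
    ℓ + ℓ        ∎)

mergeBound : ℕ → ℕ
mergeBound L = searchBound L + suc L * 2

module MergeCost (x : ℕ) where

  cost : ℕ → List ℕ → List ℕ → ℕ
  cost f A B = occ x (proj₂ (expMerge f A B))

  cost-step : ∀ f a A b B →
              cost (suc f) (a ∷ A) (b ∷ B) ≡
              occ x (proj₂ (expSearch a (b ∷ B))) + cost f (drop (proj₁ (expSearch a (b ∷ B))) (b ∷ B)) A
  cost-step f a A b B = occ-++ x (proj₂ (expSearch a (b ∷ B))) _

  cost-absent : ∀ f {A B} → occ x A ≡ 0 → occ x B ≡ 0 → cost f A B ≡ 0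
  cost-absent zero _ _ = refl
  cost-absent (suc f) {[]} _ _ = refl
  cost-absent (suc f) {a ∷ A} {[]} _ _ = refl
  cost-absent (suc f) {a ∷ A} {b ∷ B} x∉aA x∉bB = begin
      cost (suc f) (a ∷ A) (b ∷ B)                    ≡⟨ cost-step f a A b B ⟩
      occ x (proj₂ search) + cost f (drop ℓ (b ∷ B)) A ≡⟨ cong₂ _+_ (expSearch-absent {B = b ∷ B} (occ-∷-0⇒≢ A x∉aA) x∉bB)
                                                           (cost-absent f (occ-drop-0 ℓ (b ∷ B) x∉bB) (occ-∷-0 A x∉aA)) ⟩
      0                                               ∎
    where
    open ≡-Reasoning
    search = expSearch a (b ∷ B)
    ℓ = proj₁ search

  module _ (L : ℕ) where

    private
      S = searchBound L

    2≤searchBound : 2 ≤ S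
    2≤searchBound = m≤m+n 2 _

    cost-head : ∀ f {A B} → occ x A ≡ 0 → occ x B ≡ 0 → length B < 2 ^ L → cost f (x ∷ A) B ≤ S
    cost-head zero _ _ _ = z≤n
    cost-head (suc f) {B = []} _ _ _ = z≤n
    cost-head (suc f) {A} {b ∷ B} x∉A x∉bB |bB| = begin
        cost (suc f) (x ∷ A) (b ∷ B)              ≡⟨ cost-step f x A b B ⟩
        occ x log + cost f (drop ℓ (b ∷ B)) A     ≡⟨ cong (occ x log +_) (cost-absent f (occ-drop-0 ℓ (b ∷ B) x∉bB) x∉A) ⟩
        occ x log + 0                             ≡⟨ +-identityʳ _ ⟩
        occ x log                                 ≤⟨ occ≤length x log ⟩
        length log                                ≤⟨ expSearch-log-length x (b ∷ B) {L} |bB| ⟩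
        S                                         ∎
      where
      open ≤-Reasoning
      ℓ = proj₁ (expSearch x (b ∷ B))
      log = proj₂ (expSearch x (b ∷ B))

    -- x lies in the first list after r elements, or in the second after p; t bounds
    -- the logarithm of that offset and drops by one at every search that hits x.
    mutual
      cost-first : ∀ f t {r A B} → OnceAt x r A → occ x B ≡ 0 → 2 * r ≤ 2 ^ t →
                   length A < 2 ^ L → length B < 2 ^ L → cost f A B ≤ S + t * 2
      cost-first f t (here x∉A) x∉B _ _ |B| = ≤-trans (cost-head f x∉A x∉B |B|) (m≤m+n S _)
      cost-first zero t (there _ _) _ _ _ _ = z≤n
      cost-first (suc f) t {B = []} (there _ _) _ _ _ _ = z≤n
      cost-first (suc f) zero {suc r} (there _ _) _ 2r≤1 _ _ =
        contradiction (≤-trans (≤-reflexive (sym (*-suc 2 r))) 2r≤1) λ { (s≤s ()) }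
      cost-first (suc f) (suc t) {suc r} {a ∷ A} {b ∷ B} (there x≢a once) x∉bB 2r≤2^t |aA| |bB| = begin
          cost (suc f) (a ∷ A) (b ∷ B)                               ≡⟨ cost-step f a A b B ⟩
          occ x (proj₂ (expSearch a (b ∷ B))) + cost f (drop ℓ (b ∷ B)) A ≡⟨ cong (_+ cost f (drop ℓ (b ∷ B)) A)
                                                                        (expSearch-absent {B = b ∷ B} x≢a x∉bB) ⟩
          cost f (drop ℓ (b ∷ B)) A                                  ≤⟨ cost-second f t (occ-drop-0 ℓ (b ∷ B) x∉bB) once
                                                                        (*-cancelˡ-≤ 2 2r≤2^t)
                                                                        (≤-<-trans (length-drop-≤ ℓ (b ∷ B)) |bB|)
                                                                        (<-trans (n<1+n _) |aA|) ⟩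
          S + suc t * 2                                              ∎
        where
        open ≤-Reasoning
        ℓ = proj₁ (expSearch a (b ∷ B))

      cost-second : ∀ f t {p A B} → occ x A ≡ 0 → OnceAt x p B → p < 2 ^ t →
                    length A < 2 ^ L → length B < 2 ^ L → cost f A B ≤ S + suc t * 2
      cost-second zero t _ _ _ _ _ = z≤n
      cost-second (suc f) t {A = []} _ _ _ _ _ = z≤n
      cost-second (suc f) t {p} {a ∷ A} {b ∷ B} x∉aA once p<2^t |aA| |bB| =
        ≤-trans (≤-reflexive (cost-step f a A b B)) (afterSearch (proj₂ hits))
        where
        x∉A : occ x A ≡ 0
        x∉A = occ-∷-0 A x∉aA
        ℓ = proj₁ (expSearch a (b ∷ B))
        c = occ x (proj₂ (expSearch a (b ∷ B)))
        hits : c ≤ 2 × (c ≡ 0 ⊎ (1 ≤ suc p × suc p ≤ suc (2 * ℓ)))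
        hits = expSearch-hits {x} {a} {b ∷ B} (probeCost-OnceAt {B = b ∷ B} (occ-∷-0⇒≢ A x∉aA) once)
        |D| : length (drop ℓ (b ∷ B)) < 2 ^ L
        |D| = ≤-<-trans (length-drop-≤ ℓ (b ∷ B)) |bB|
        |A| : length A < 2 ^ L
        |A| = <-trans (n<1+n _) |aA|
        afterSearch : c ≡ 0 ⊎ (1 ≤ suc p × suc p ≤ suc (2 * ℓ)) → c + cost f (drop ℓ (b ∷ B)) A ≤ S + suc t * 2
        afterSearch hitOrNot with ℓ ≤? p
        ... | no ℓ≰p = begin
            c + cost f (drop ℓ (b ∷ B)) A ≡⟨ cong (c +_) (cost-absent f (OnceAt-drop-past ℓ once (≰⇒> ℓ≰p)) x∉A) ⟩
            c + 0                         ≡⟨ +-identityʳ c ⟩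
            c                             ≤⟨ proj₁ hits ⟩
            2                             ≤⟨ ≤-trans 2≤searchBound (m≤m+n S _) ⟩
            S + suc t * 2                 ∎
          where open ≤-Reasoning
        afterSearch (inj₁ c≡0) | yes ℓ≤p = begin
            c + cost f (drop ℓ (b ∷ B)) A ≡⟨ cong (_+ cost f (drop ℓ (b ∷ B)) A) c≡0 ⟩
            cost f (drop ℓ (b ∷ B)) A     ≤⟨ cost-first f (suc t) (OnceAt-drop ℓ once ℓ≤p) x∉A
                                               (*-monoʳ-≤ 2 (≤-trans (m∸n≤m p ℓ) (<⇒≤ p<2^t))) |D| |A| ⟩
            S + suc t * 2                 ∎
          where open ≤-Reasoning
        afterSearch (inj₂ (_ , 1+p≤1+2ℓ)) | yes ℓ≤p = begin
            c + cost f (drop ℓ (b ∷ B)) A ≤⟨ +-mono-≤ (proj₁ hits)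
                                               (cost-first f t (OnceAt-drop ℓ once ℓ≤p) x∉A
                                                 (≤-trans (p≤2ℓ⇒2[p∸ℓ]≤p ℓ≤p (s≤s⁻¹ 1+p≤1+2ℓ)) (<⇒≤ p<2^t)) |D| |A|) ⟩
            2 + (S + t * 2)               ≡⟨ +-comm 2 (S + t * 2) ⟩
            S + t * 2 + 2                 ≡⟨ +-assoc S (t * 2) 2 ⟩
            S + (t * 2 + 2)               ≡⟨ cong (S +_) (+-comm (t * 2) 2) ⟩
            S + suc t * 2                 ∎
          where open ≤-Reasoning

    merge-occ : ∀ f {A B} → occ x A + occ x B ≤ 1 → length A < 2 ^ L → length B < 2 ^ L →
                cost f A B ≤ (occ x A + occ x B) * mergeBound L
    merge-occ f {A} {B} atMostOnce |A| |B| with occ x A in occA | occ x B in occB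
    ... | 0 | 0 = ≤-reflexive (cost-absent f occA occB)
    ... | 1 | 0 with p , once ← occ≡1⇒OnceAt A occA =
      ≤-trans (cost-first f (suc L) once occB (*-monoʳ-≤ 2 (<⇒≤ (<-trans (OnceAt⇒<length once) |A|))) |A| |B|)
        (m≤m+n _ 0)
    ... | 0 | 1 with p , once ← occ≡1⇒OnceAt B occB =
      ≤-trans (cost-second f L occA once (<-trans (OnceAt⇒<length once) |B|) |A| |B|) (m≤m+n _ 0)
    ... | suc (suc _) | _ = contradiction atMostOnce λ { (s≤s ()) }
    ... | 1 | suc _ = contradiction atMostOnce λ { (s≤s ()) }
    ... | 0 | suc (suc _) = contradiction atMostOnce λ { (s≤s ()) }

merge-↭ : ∀ f A B → proj₁ (expMerge f A B) ↭ A ++ B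
merge-↭ zero A B = ↭-refl
merge-↭ (suc f) [] B = ↭-refl
merge-↭ (suc f) (a ∷ A) [] = ↭-reflexive (sym (++-identityʳ (a ∷ A)))
merge-↭ (suc f) (a ∷ A) (b ∷ B) = begin
    take ℓ bB ++ a ∷ rest             ↭⟨ shift a (take ℓ bB) rest ⟩
    a ∷ take ℓ bB ++ rest             ↭⟨ ↭-prep a (++⁺ˡ (take ℓ bB) (merge-↭ f (drop ℓ bB) A)) ⟩
    a ∷ take ℓ bB ++ drop ℓ bB ++ A   ≡⟨ cong (a ∷_) (sym (++-assoc (take ℓ bB) (drop ℓ bB) A)) ⟩
    a ∷ (take ℓ bB ++ drop ℓ bB) ++ A ≡⟨ cong (λ ys → a ∷ ys ++ A) (take++drop≡id ℓ bB) ⟩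
    a ∷ bB ++ A                       ↭⟨ ↭-prep a (++-comm bB A) ⟩
    a ∷ A ++ bB                       ∎
  where
  open PermutationReasoning
  bB = b ∷ B
  ℓ = proj₁ (expSearch a bB)
  rest = proj₁ (expMerge f (drop ℓ bB) A)

msort-↭ : ∀ f xs → proj₁ (msort f xs) ↭ xs
msort-↭ zero xs = ↭-refl
msort-↭ (suc f) [] = ↭-refl
msort-↭ (suc f) (_ ∷ []) = ↭-refl
msort-↭ (suc f) xs@(_ ∷ _ ∷ _) = begin
    proj₁ (expMerge (length xs) s₁ s₂) ↭⟨ merge-↭ (length xs) s₁ s₂ ⟩
    s₁ ++ s₂                           ↭⟨ ++⁺ (msort-↭ f T) (msort-↭ f D) ⟩
    T ++ D                             ≡⟨ take++drop≡id ⌈ length xs /2⌉ xs ⟩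
    xs                                 ∎
  where
  open PermutationReasoning
  T = take ⌈ length xs /2⌉ xs
  D = drop ⌈ length xs /2⌉ xs
  s₁ = proj₁ (msort f T)
  s₂ = proj₁ (msort f D)

halves-length : ∀ {m} (xs : List ℕ) → length xs ≤ 2 * m →
                length (take ⌈ length xs /2⌉ xs) ≤ m × length (drop ⌈ length xs /2⌉ xs) ≤ m
halves-length {m} xs |xs|≤2m =
    ≤-trans (≤-reflexive (length-take h xs)) (≤-trans (m⊓n≤m h n) h≤m)
  , ≤-trans (≤-reflexive (trans (length-drop h xs) n∸h≡⌊n/2⌋)) (≤-trans (⌊n/2⌋≤⌈n/2⌉ n) h≤m)
  where
  n = length xs
  h = ⌈ n /2⌉
  h≤m : h ≤ m
  h≤m = ≤-trans (⌈n/2⌉-mono (≤-trans |xs|≤2m (≤-reflexive (cong (m +_) (+-identityʳ m)))))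
                (≤-reflexive (sym (n≡⌈n+n/2⌉ m)))
  n∸h≡⌊n/2⌋ : n ∸ h ≡ ⌊ n /2⌋
  n∸h≡⌊n/2⌋ = trans (cong (_∸ h) (sym (⌊n/2⌋+⌈n/2⌉≡n n))) (m+n∸n≡m ⌊ n /2⌋ h)

mergeBound-mono : ∀ L → mergeBound L ≤ mergeBound (suc L)
mergeBound-mono L = +-mono-≤ (+-mono-≤ (*-monoˡ-≤ 2 (n≤1+n (suc L))) (*-monoˡ-≤ 2 (n≤1+n L))) (*-monoˡ-≤ 2 (n≤1+n (suc L)))

level-sum : ∀ {c X Y} L a b → a + b ≡ c → X ≤ L * Y → a * X + (b * X + c * Y) ≤ c * (suc L * Y)
level-sum {c} {X} {Y} L a b a+b≡c X≤LY = begin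
    a * X + (b * X + c * Y) ≡⟨ sym (+-assoc (a * X) (b * X) (c * Y)) ⟩
    a * X + b * X + c * Y   ≡⟨ cong (_+ c * Y) (sym (*-distribʳ-+ X a b)) ⟩
    (a + b) * X + c * Y     ≡⟨ cong (λ k → k * X + c * Y) a+b≡c ⟩
    c * X + c * Y           ≡⟨ sym (*-distribˡ-+ c X Y) ⟩
    c * (X + Y)             ≤⟨ *-monoʳ-≤ c (+-monoˡ-≤ Y X≤LY) ⟩
    c * (L * Y + Y)         ≡⟨ cong (c *_) (+-comm (L * Y) Y) ⟩
    c * (suc L * Y)         ∎
  where open ≤-Reasoning

msort-occ : ∀ x L f xs → length xs ≤ 2 ^ L → occ x xs ≤ 1 →
            occ x (proj₂ (msort f xs)) ≤ occ x xs * (L * mergeBound L)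
msort-occ x L zero xs _ _ = z≤n
msort-occ x L (suc f) [] _ _ = z≤n
msort-occ x L (suc f) (_ ∷ []) _ _ = z≤n
msort-occ x zero (suc f) (_ ∷ _ ∷ _) (s≤s ()) _
msort-occ x (suc L) (suc f) xs@(_ ∷ _ ∷ _) |xs| atMostOnce = begin
    occ x (l₁ ++ l₂ ++ l₃)           ≡⟨ trans (occ-++ x l₁ (l₂ ++ l₃)) (cong (occ x l₁ +_) (occ-++ x l₂ l₃)) ⟩
    occ x l₁ + (occ x l₂ + occ x l₃) ≤⟨ +-mono-≤ (msort-occ x L f T |T| oT≤1)
                                         (+-mono-≤ (msort-occ x L f D |D| oD≤1) merge-cost) ⟩
    oT * K + (oD * K + o * M)         ≤⟨ level-sum L oT oD split (*-monoʳ-≤ L (mergeBound-mono L)) ⟩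
    o * (suc L * M)                   ∎
  where
  open ≤-Reasoning
  n = length xs
  T = take ⌈ n /2⌉ xs
  D = drop ⌈ n /2⌉ xs
  s₁ = msort f T
  s₂ = msort f D
  l₁ = proj₂ s₁
  l₂ = proj₂ s₂
  l₃ = proj₂ (expMerge n (proj₁ s₁) (proj₁ s₂))
  o = occ x xs
  oT = occ x T
  oD = occ x D
  K = L * mergeBound L
  M = mergeBound (suc L)
  split : oT + oD ≡ o
  split = trans (sym (occ-++ x T D)) (cong (occ x) (take++drop≡id ⌈ n /2⌉ xs))
  oT≤1 : oT ≤ 1
  oT≤1 = ≤-trans (m≤m+n oT oD) (≤-trans (≤-reflexive split) atMostOnce)
  oD≤1 : oD ≤ 1
  oD≤1 = ≤-trans (m≤n+m oD oT) (≤-trans (≤-reflexive split) atMostOnce)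
  |T| : length T ≤ 2 ^ L
  |T| = proj₁ (halves-length xs |xs|)
  |D| : length D ≤ 2 ^ L
  |D| = proj₂ (halves-length xs |xs|)
  2^L<2^1+L : 2 ^ L < 2 ^ suc L
  2^L<2^1+L = ^-monoʳ-< 2 (s≤s (s≤s z≤n)) (n<1+n L)
  sorted-occ : occ x (proj₁ s₁) + occ x (proj₁ s₂) ≡ o
  sorted-occ = trans (cong₂ _+_ (occ-↭ x (msort-↭ f T)) (occ-↭ x (msort-↭ f D))) split
  merge-cost : occ x l₃ ≤ o * M
  merge-cost = subst (λ k → occ x l₃ ≤ k * M) sorted-occ
    (MergeCost.merge-occ x (suc L) n {proj₁ s₁} {proj₁ s₂} (≤-trans (≤-reflexive sorted-occ) atMostOnce)
      (≤-<-trans (≤-reflexive (↭-length (msort-↭ f T))) (≤-<-trans |T| 2^L<2^1+L))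
      (≤-<-trans (≤-reflexive (↭-length (msort-↭ f D))) (≤-<-trans |D| 2^L<2^1+L)))

≤2^⌈log₂⌉ : ∀ n → n ≤ 2 ^ ⌈log₂ n ⌉
≤2^⌈log₂⌉ = <-rec _ step
  where
  step : ∀ n → (∀ {m} → m < n → m ≤ 2 ^ ⌈log₂ m ⌉) → n ≤ 2 ^ ⌈log₂ n ⌉
  step zero _ = z≤n
  step (suc zero) _ = s≤s z≤n
  step n@(suc (suc m)) rec = begin
      n                                    ≡⟨ sym (⌊n/2⌋+⌈n/2⌉≡n n) ⟩
      ⌊ n /2⌋ + ⌈ n /2⌉                    ≤⟨ +-monoˡ-≤ ⌈ n /2⌉ (⌊n/2⌋≤⌈n/2⌉ n) ⟩
      ⌈ n /2⌉ + ⌈ n /2⌉                    ≤⟨ +-mono-≤ half≤ half≤ ⟩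
      2 ^ (k ∸ 1) + 2 ^ (k ∸ 1)            ≡⟨ double (⌈log₂⌉-mono-≤ {2} {n} (s≤s (s≤s z≤n))) ⟩
      2 ^ k                                ∎
    where
    open ≤-Reasoning
    k = ⌈log₂ n ⌉
    half≤ : ⌈ n /2⌉ ≤ 2 ^ (k ∸ 1)
    half≤ = subst (λ j → ⌈ n /2⌉ ≤ 2 ^ j) (⌈log₂⌈n/2⌉⌉≡⌈log₂n⌉∸1 n) (rec (⌈n/2⌉<n m))
    double : ∀ {j} → 1 ≤ j → 2 ^ (j ∸ 1) + 2 ^ (j ∸ 1) ≡ 2 ^ j
    double {suc j} _ = cong (2 ^ j +_) (sym (+-identityʳ (2 ^ j)))

mergeBound-quadratic : ∀ L → L * mergeBound L ≤ 10 * L ^ 2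
mergeBound-quadratic zero = z≤n
-- mergeBound L = 6L + 4, and L (6L + 4) + 4 (L - 1) L = 10 L².
mergeBound-quadratic (suc m) = ≤-trans (m≤m+n _ (4 * m * suc m)) (≤-reflexive (solve 1
    (λ m → (con 1 :+ m) :* (((con 2 :+ m) :* con 2 :+ (con 1 :+ m) :* con 2) :+ (con 2 :+ m) :* con 2)
             :+ con 4 :* m :* (con 1 :+ m)
           := con 10 :* ((con 1 :+ m) :* ((con 1 :+ m) :* con 1))) refl m))
  where open +-*-Solver

corollary37 : ∃₂ λ (c n₀ : ℕ) → ∀ (xs : List ℕ) → n₀ ≤ length xs → Unique xs →
                  ∀ x → x ∈ xs → participations x xs ≤ c * (⌈log₂ length xs ⌉ ^ 2)
corollary37 = 10 , 0 , λ xs _ unique x _ →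
  let L = ⌈log₂ length xs ⌉
      atMostOnce = Unique⇒occ≤1 x unique
  in begin
    participations x xs            ≤⟨ msort-occ x L (length xs) xs (≤2^⌈log₂⌉ (length xs)) atMostOnce ⟩
    occ x xs * (L * mergeBound L)  ≤⟨ *-monoˡ-≤ (L * mergeBound L) atMostOnce ⟩
    1 * (L * mergeBound L)         ≡⟨ *-identityˡ _ ⟩
    L * mergeBound L               ≤⟨ mergeBound-quadratic L ⟩
    10 * L ^ 2                     ∎
  where open ≤-Reasoning
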